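{- Let $(G,k)$ be a reduced instance of \textsc{Trivially Perfect Editing}, let $X$ be a small TP-modulator of $G$, and let $(T,\mathcal{B})$ be the universal clique decomposition of $G-X$. If $u,v\in B_t$ for some bag $B_t\in\mathcal{B}$, then $N^X(u)\subseteq N^X(v)$ or $N^X(v)\subseteq N^X(u)$.
   Context: Graphs are finite, simple, undirected; a graph is trivially perfect if it has no induced $C_4$ or $P_4$. \textsc{Trivially Perfect Editing}: given $(G,k)$, decide if some $S\subseteq\binom{V(G)}{2}$, $|S|\le k$, makes $(V(G),E(G)\triangle S)$ trivially perfect. The instance $(G,k)$ is reduced if neither of the following holds: (i) there is a non-edge $uv$ such that the complement of $G[N(u)\cap N(v)]$ has a matching of size $\ge k+1$; (ii) there is an edge $uv$ and $k+1$ pairwise disjoint non-adjacent pairs $\{a,b\}$ with $a\in N(u)\setminus N[v]$, $b\in N(v)\setminus N[u]$. An obstruction is a 4-vertex set $W$ with $G[W]\cong C_4$ or $P_4$. $X\subseteq V(G)$ is a TP-modulator if every obstruction $W$ has $|W\cap X|\ge2$, and if $|W\cap X|=2$, $W\cap X=\{x_1,x_2\}$, $W\setminus X=\{y_1,y_2\}$, then $G[W]$ is not the $C_4$ $x_1-y_1-y_2-x_2-x_1$ nor the $P_4$ $x_1-y_1-y_2-x_2$; it is small if $|X|\le 4k$. A universal clique decomposition of a trivially perfect graph $H$ is a pair $(T,\{B_t\}_{t\in V(T)})$ with $T$ a rooted forest and the $B_t$ a partition of $V(H)$ into nonempty sets such that if $vw\in E(H)$, $v\in B_t$, $w\in B_s$,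 then $t=s$ or one of $t,s$ is an ancestor of the other, and each $B_t$ is exactly the set of universal vertices of $H[\bigcup_{s\in V(T_t)}B_s]$, $T_t$ the subtree rooted at $t$; it is unique up to isomorphism. For $v\notin X$, $N^X(v)=N(v)\cap X$. -}

module Defs where

open import Data.Nat using (ℕ; suc; _+_; _*_; _≤_)
open import Data.Bool using (Bool; true; false; if_then_else_)
open import Data.Vec using (lookup)
open import Data.Fin using (Fin)
open import Data.Fin.Subset using (Subset; _∈_; _∉_; ∣_∣)
open import Data.Maybe using (Maybe; just; nothing)
open import Data.Product using (Σ; ∃; ∃-syntax; _×_; _,_)
open import Data.Sum using (_⊎_; inj₁; inj₂)
open import Data.Empty using (⊥)
open import Relation.Nullary using (¬_)
open import Relation.Binary.PropositionalEquality using (_≡_; _≢_)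
open import Function.Definitions using (Injective)
open import Function.Bundles using (_⇔_)

record Graph (n : ℕ) : Set where
  field
    adj    : Fin n → Fin n → Bool
    sym    : ∀ u v → adj u v ≡ adj v u
    irrefl : ∀ v → adj v v ≡ false

module _ {n : ℕ} (G : Graph n) where
  open Graph G

  Adj : Fin n → Fin n → Set
  Adj u v = adj u v ≡ true

  NonEdge : Fin n → Fin n → Set
  NonEdge u v = u ≢ v × adj u v ≡ false

  IsP4 : Fin n → Fin n → Fin n → Fin n → Set
  IsP4 a b c d = Adj a b × Adj b c × Adj c d
               × NonEdge a c × NonEdge b d × NonEdge a d

  IsC4 : Fin n → Fin n → Fin n → Fin n → Set
  IsC4 a b c d = Adj a b × Adj b c × Adj c d × Adj d a
               × NonEdge a c × NonEdge b d

  Distinct4 : Fin n → Fin n → Fin n → Fin n → Set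
  Distinct4 a b c d = a ≢ b × a ≢ c × a ≢ d × b ≢ c × b ≢ d × c ≢ d

  -- W = {a,b,c,d} is an obstruction (G[W] ≅ C4 or P4), given by an ordering
  -- of its vertices along the path / cycle.
  Obstruction : Fin n → Fin n → Fin n → Fin n → Set
  Obstruction a b c d = Distinct4 a b c d × (IsC4 a b c d ⊎ IsP4 a b c d)

  -- k+1 pairwise disjoint pairs {f i, g i}: the map [f,g] is injective.
  DisjointPairs : (k : ℕ) → (Fin (suc k) → Fin n) → (Fin (suc k) → Fin n) → Set
  DisjointPairs k f g = Injective _≡_ _≡_ (λ (x : Fin (suc k) ⊎ Fin (suc k)) → pick x)
    where
      pick : Fin (suc k) ⊎ Fin (suc k) → Fin n
      pick (inj₁ i) = f i
      pick (inj₂ i) = g i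

  -- Reduction rule (i) applies: a non-edge uv such that the complement of
  -- G[N(u) ∩ N(v)] has a matching of size ≥ k+1.
  RuleI : ℕ → Set
  RuleI k = ∃[ u ] ∃[ v ] NonEdge u v ×
    ∃[ f ] ∃[ g ] DisjointPairs k f g ×
      (∀ i → Adj u (f i) × Adj v (f i) × Adj u (g i) × Adj v (g i)
             × NonEdge (f i) (g i))

  RuleII : ℕ → Set
  RuleII k = ∃[ u ] ∃[ v ] Adj u v ×
    ∃[ f ] ∃[ g ] DisjointPairs k f g ×
      (∀ i → (Adj u (f i) × f i ≢ v × ¬ Adj v (f i))
           × (Adj v (g i) × g i ≢ u × ¬ Adj u (g i))
           × NonEdge (f i) (g i))

  Reduced : ℕ → Set
  Reduced k = ¬ RuleI k × ¬ RuleII k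

  -- number of elements of {a,b,c,d} lying in X (for pairwise distinct a,b,c,d)
  count4 : Subset n → Fin n → Fin n → Fin n → Fin n → ℕ
  count4 X a b c d = ind a + ind b + ind c + ind d
    where
      ind : Fin n → ℕ
      ind v = if lookup X v then 1 else 0

  TPModulator : Subset n → Set
  TPModulator X =
    (∀ a b c d → Obstruction a b c d → 2 ≤ count4 X a b c d)
    × (∀ x₁ y₁ y₂ x₂ → Distinct4 x₁ y₁ y₂ x₂ → x₁ ∈ X → x₂ ∈ X → y₁ ∉ X → y₂ ∉ X →
         ¬ (IsC4 x₁ y₁ y₂ x₂ ⊎ IsP4 x₁ y₁ y₂ x₂))

  SmallTPModulator : ℕ → Subset n → Set
  SmallTPModulator k X = TPModulator X × ∣ X ∣ ≤ 4 * k

data Anc {m : ℕ} (parent : Fin m → Maybe (Fin m)) : Fin m → Fin m → Set where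
  par  : ∀ {s t} → parent t ≡ just s → Anc parent s t
  step : ∀ {s r t} → parent t ≡ just r → Anc parent s r → Anc parent s t

record RootedForest (m : ℕ) : Set where
  field
    parent  : Fin m → Maybe (Fin m)
    acyclic : ∀ t → ¬ Anc parent t t

module _ {n : ℕ} (G : Graph n) (X : Subset n) where

  -- A universal clique decomposition of the trivially perfect graph G - X
  -- (vertex set {v | v ∉ X}, induced adjacency).
  record UCD : Set where
    field
      m      : ℕ
      forest : RootedForest m
      bag    : Fin n → Fin m    -- only meaningful on vertices v ∉ X

    open RootedForest forest

    _≺_ : Fin m → Fin m → Set
    s ≺ t = Anc parent s t

    InSubtree : Fin m → Fin n → Set
    InSubtree t w = w ∉ X × (bag w ≡ t ⊎ t ≺ bag w)

    Universal : Fin m → Fin n → Set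
    Universal t v = InSubtree t v × (∀ w → InSubtree t w → w ≢ v → Adj G v w)

    field
      nonempty  : ∀ t → ∃[ v ] (v ∉ X × bag v ≡ t)
      edges     : ∀ v w → v ∉ X → w ∉ X → Adj G v w →
                  bag v ≡ bag w ⊎ bag v ≺ bag w ⊎ bag w ≺ bag v
      universal : ∀ t v → v ∉ X → (bag v ≡ t ⇔ Universal t v)

NXSubset : ∀ {n} → Graph n → Subset n → Fin n → Fin n → Set
NXSubset G X u v = ∀ x → x ∈ X → Adj G u x → Adj G v x

-- Two vertices u ≠ v of the same bag are universal in the same subtree, hence
-- adjacent. If their X-neighbourhoods were incomparable, pick x ∈ N^X(u) ∖ N(v)
-- and y ∈ N^X(v) ∖ N(u); then x - u - v - y is an induced P4 (or, if xy is an
-- edge, an induced C4 closed by xy) whose two middle vertices lie outside X and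
-- whose two ends lie in X — exactly what a TP-modulator forbids.
module Submission where

open import Defs
open import Data.Nat using (ℕ)
open import Data.Fin using (Fin)
open import Data.Fin.Subset using (Subset; _∉_; _∈_)
open import Data.Fin.Subset.Properties using (_∈?_)
open import Data.Fin.Properties using (any?) renaming (_≟_ to _≟ᶠ_)
open import Data.Bool using (true)
open import Data.Bool.Properties using (¬-not) renaming (_≟_ to _≟ᵇ_)
open import Data.Sum using (_⊎_; inj₁; inj₂)
open import Data.Product using (∃; _×_; _,_; proj₂)
open import Relation.Nullary using (¬_; Dec; yes; no; contradiction)
open import Relation.Nullary.Decidable using (_×-dec_; ¬?)
open import Relation.Binary.PropositionalEquality using (_≡_; _≢_; refl; sym; trans)
open import Function.Bundles using (Equivalence)

module _ {n : ℕ} (G : Graph n) where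
  open Graph G using (adj)

  Adj? : ∀ u v → Dec (Adj G u v)
  Adj? u v = adj u v ≟ᵇ true

  Adj-sym : ∀ {u v} → Adj G u v → Adj G v u
  Adj-sym {u} {v} uv = trans (Graph.sym G v u) uv

  Adj⇒≢ : ∀ {u v} → Adj G u v → u ≢ v
  Adj⇒≢ {u} uu refl = contradiction (trans (sym (Graph.irrefl G u)) uu) λ ()

  ¬Adj⇒NonEdge : ∀ {u v} → u ≢ v → ¬ Adj G u v → NonEdge G u v
  ¬Adj⇒NonEdge u≢v ¬uv = u≢v , ¬-not ¬uv

  private-neighbours⇒obstruction : ∀ {x u v y} →
    Adj G u v → Adj G u x → ¬ Adj G v x → Adj G v y → ¬ Adj G u y →
    x ≢ v → u ≢ y →
    Distinct4 G x u v y × (IsC4 G x u v y ⊎ IsP4 G x u v y)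
  private-neighbours⇒obstruction {x} {u} {v} {y} uv ux ¬vx vy ¬uy x≢v u≢y =
    distinct , shape (Adj? x y)
    where
    x≢y : x ≢ y
    x≢y refl = ¬vx vy

    distinct : Distinct4 G x u v y
    distinct = (λ x≡u → Adj⇒≢ ux (sym x≡u)) , x≢v , x≢y , Adj⇒≢ uv , u≢y , Adj⇒≢ vy

    xv : NonEdge G x v
    xv = ¬Adj⇒NonEdge x≢v (λ xv → ¬vx (Adj-sym xv))

    uy : NonEdge G u y
    uy = ¬Adj⇒NonEdge u≢y ¬uy

    shape : Dec (Adj G x y) → IsC4 G x u v y ⊎ IsP4 G x u v y
    shape (yes xy) = inj₁ (Adj-sym ux , uv , vy , Adj-sym xy , xv , uy)
    shape (no ¬xy) = inj₂ (Adj-sym ux , uv , vy , xv , uy , ¬Adj⇒NonEdge x≢y ¬xy)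

  module _ (X : Subset n) where

    ∉∈⇒≢ : ∀ {a b} → a ∉ X → b ∈ X → a ≢ b
    ∉∈⇒≢ a∉X b∈X refl = a∉X b∈X

    PrivateNeighbour : Fin n → Fin n → Fin n → Set
    PrivateNeighbour u v x = x ∈ X × Adj G u x × ¬ Adj G v x

    NXSubset-or-PrivateNeighbour : ∀ u v →
      NXSubset G X u v ⊎ ∃ (PrivateNeighbour u v)
    NXSubset-or-PrivateNeighbour u v
      with any? (λ x → x ∈? X ×-dec Adj? u x ×-dec ¬? (Adj? v x))
    ... | yes witness = inj₂ witness
    ... | no ¬witness = inj₁ subset
      where
      subset : NXSubset G X u v
      subset x x∈X ux with Adj? v x
      ... | yes vx = vx
      ... | no ¬vx = contradiction (x , x∈X , ux , ¬vx) ¬witness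

    NX-comparable : ∀ {u v} → Adj G u v → u ∉ X → v ∉ X →
      TPModulator G X → NXSubset G X u v ⊎ NXSubset G X v u
    NX-comparable {u} {v} uv u∉X v∉X (_ , no-x-y-y-x)
      with NXSubset-or-PrivateNeighbour u v | NXSubset-or-PrivateNeighbour v u
    ... | inj₁ u⊆v | _ = inj₁ u⊆v
    ... | _ | inj₁ v⊆u = inj₂ v⊆u
    ... | inj₂ (x , x∈X , ux , ¬vx) | inj₂ (y , y∈X , vy , ¬uy)
      with private-neighbours⇒obstruction uv ux ¬vx vy ¬uy
             (λ x≡v → ∉∈⇒≢ v∉X x∈X (sym x≡v)) (∉∈⇒≢ u∉X y∈X)
    ... | distinct , obstruction =
      contradiction obstruction (no-x-y-y-x x u v y distinct x∈X y∈X u∉X v∉X)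

sameBag⇒Adj : ∀ {n} {G : Graph n} {X : Subset n} (D : UCD G X) {t u v} →
  u ∉ X → v ∉ X → UCD.bag D u ≡ t → UCD.bag D v ≡ t → u ≢ v → Adj G u v
sameBag⇒Adj D {t} {u} {v} u∉X v∉X bag-u bag-v u≢v =
  proj₂ (Equivalence.to (UCD.universal D t u u∉X) bag-u)
    v (v∉X , inj₁ bag-v) (λ v≡u → u≢v (sym v≡u))

lemma6 : ∀ {n} (G : Graph n) (k : ℕ) (X : Subset n) →
    Reduced G k → SmallTPModulator G k X →
    (D : UCD G X) → ∀ t u v → u ∉ X → v ∉ X →
    UCD.bag D u ≡ t → UCD.bag D v ≡ t →
    NXSubset G X u v ⊎ NXSubset G X v u
lemma6 G k X _ (modulator , _) D t u v u∉X v∉X bag-u bag-v with u ≟ᶠ v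
... | yes refl = inj₁ λ _ _ ux → ux
... | no u≢v = NX-comparable G X (sameBag⇒Adj D u∉X v∉X bag-u bag-v u≢v) u∉X v∉X modulator
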